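{- Let $A$ be a symmetric integer matrix such that $$A\pmod 4=\mathrm{diag}\Big(r\begin{pmatrix}2&1\\1&2\end{pmatrix}, s\begin{pmatrix}0&1\\1&0\end{pmatrix}, t\begin{pmatrix}0&2\\2&0\end{pmatrix}, p(2), m(0)\Big)$$ for non-negative integers $r,s,t,m$ and $p\ge3$. Then there is an integer matrix $P$ with $\det(P)=\pm1$ such that $$P^TAP\pmod 4=\mathrm{diag}\Big(r\begin{pmatrix}2&1\\1&2\end{pmatrix}, s\begin{pmatrix}0&1\\1&0\end{pmatrix}, (t+1)\begin{pmatrix}0&2\\2&0\end{pmatrix}, (p-2)(2), m(0)\Big).$$ In particular, $A$ has a normal form in which the parameter $p$ is at most $2$.
   Context: "$M\pmod 4$" is entrywise reduction into $\{0,1,2,3\}$; $\mathrm{diag}(\dots)$ with multiplicities denotes the block diagonal matrix with the indicated numbers of copies of each block. A normal form of a symmetric integer matrix $A$ with even diagonal is a matrix $\mathrm{diag}\big(r\begin{pmatrix}2&1\\1&2\end{pmatrix}, s\begin{pmatrix}0&1\\1&0\end{pmatrix}, t\begin{pmatrix}0&2\\2&0\end{pmatrix}, p(2), m(0)\big)$ equal to $P^TAP\pmod 4$ for some integer $P$ with $\det P=\pm1$. -}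

module Defs where

open import Data.Nat as ℕ using (ℕ; zero; suc; _<ᵇ_; _∸_)
open import Data.Bool using (Bool; true; false; if_then_else_; _∧_)
open import Data.Fin using (Fin; zero; suc; toℕ; punchIn)
open import Data.Integer using (ℤ; +_; -_; _+_; _*_; _%ℕ_)
open import Data.List using (List; []; _∷_; replicate; _++_)
open import Data.Product using (_×_)
open import Data.Sum using (_⊎_)
open import Relation.Binary.PropositionalEquality using (_≡_)

Mat : ℕ → Set
Mat n = Fin n → Fin n → ℤ

∑ : ∀ {n} → (Fin n → ℤ) → ℤ
∑ {zero}  f = + 0
∑ {suc n} f = f zero + ∑ (λ i → f (suc i))

transpose : ∀ {n} → Mat n → Mat n
transpose M i j = M j i

infixl 7 _⊗_
_⊗_ : ∀ {n} → Mat n → Mat n → Mat n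
(M ⊗ N) i j = ∑ (λ k → M i k * N k j)

Symmetric : ∀ {n} → Mat n → Set
Symmetric M = ∀ i j → M i j ≡ M j i

sgn : ℕ → ℤ
sgn zero    = + 1
sgn (suc k) = - sgn k

det : ∀ {n} → Mat n → ℤ
det {zero}  M = + 1
det {suc n} M =
  ∑ (λ j → sgn (toℕ j) * M zero j * det (λ a b → M (suc a) (punchIn j b)))

Unimodular : ∀ {n} → Mat n → Set
Unimodular P = det P ≡ + 1 ⊎ det P ≡ - (+ 1)

data Block : Set where
  H U V Two Zero : Block

blockSize : Block → ℕ
blockSize H    = 2
blockSize U    = 2
blockSize V    = 2
blockSize Two  = 1
blockSize Zero = 1

blockEntry : Block → ℕ → ℕ → ℕ
blockEntry H    0 0 = 2
blockEntry H    0 1 = 1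
blockEntry H    1 0 = 1
blockEntry H    1 1 = 2
blockEntry U    0 1 = 1
blockEntry U    1 0 = 1
blockEntry V    0 1 = 2
blockEntry V    1 0 = 2
blockEntry Two  0 0 = 2
blockEntry _    _ _ = 0

dim : List Block → ℕ
dim []       = 0
dim (b ∷ bs) = blockSize b ℕ.+ dim bs

diagEntry : List Block → ℕ → ℕ → ℕ
diagEntry []       i j = 0
diagEntry (b ∷ bs) i j =
  if (i <ᵇ blockSize b) ∧ (j <ᵇ blockSize b) then blockEntry b i j
  else if (i <ᵇ blockSize b) then 0
  else if (j <ᵇ blockSize b) then 0
  else diagEntry bs (i ∸ blockSize b) (j ∸ blockSize b)

normalBlocks : ℕ → ℕ → ℕ → ℕ → ℕ → List Block
normalBlocks r s t p m =
  replicate r H ++ replicate s U ++ replicate t V ++ replicate p Two ++ replicate m Zero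

_≡mod4_ : ∀ {n} → Mat n → List Block → Set
_≡mod4_ {n} M bs = (n ≡ dim bs) × (∀ i j → M i j %ℕ 4 ≡ diagEntry bs (toℕ i) (toℕ j))

HasNormalForm : ∀ {n} → Mat n → ℕ → ℕ → ℕ → ℕ → ℕ → Set
HasNormalForm {n} A r s t p m =
  Data.Product.Σ (Mat n) (λ P → Unimodular P × ((transpose P ⊗ A ⊗ P) ≡mod4 normalBlocks r s t p m))

{-# OPTIONS --safe #-}
-- A column operation P ↦ P E adding one column of P to an adjacent one keeps det P (the
-- determinant is additive in a column and vanishes when two adjacent columns agree), and
-- it changes the Gram matrix Pᵀ A P by the same operation on rows and on columns, which is
-- compatible with reduction mod 4. Five such operations inside three consecutive blocks (2)
-- turn diag(2, 2, 2) into a matrix ≡ diag(V, 2) (mod 4), leave the entries away from these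
-- three indices unchanged and keep the entries between them and the rest ≡ 0 (mod 4).
-- So (2)(2)(2) can be traded for V (2) anywhere in the block list; repeating the trade
-- brings p down to at most 2.

module Submission where

open import Defs
open import Data.Nat using (ℕ; _≤_; _∸_; suc)
open import Data.Product using (_×_; ∃-syntax)

open import Algebra.Properties.Semiring.Sum as SumProperties using ()
open import Data.Bool using (true; false; T)
open import Data.Empty using (⊥-elim)
open import Data.Fin using (Fin; zero; suc; toℕ; punchIn; punchOut; inject₁; _↑ˡ_; _↑ʳ_; splitAt)
open import Data.Fin.Patterns using (0F; 1F; 2F)
open import Data.Fin.Properties
  using (suc-injective; toℕ<n; toℕ-inject₁; toℕ-↑ˡ; toℕ-↑ʳ; ↑ˡ-injective; ↑ʳ-injective;
         splitAt⁻¹-↑ˡ; splitAt⁻¹-↑ʳ; punchIn-injective; punchIn-punchOut; punchInᵢ≢i; any?)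
  renaming (_≟_ to _≟ᶠ_)
open import Data.Integer as ℤ using (ℤ; +_; -_; _+_; _-_; _*_; 0ℤ; 1ℤ; _%ℕ_; _/ℕ_)
open import Data.Integer.DivMod using (a≡a%ℕn+[a/ℕn]*n; n%ℕd<d)
open import Data.Integer.Divisibility.Signed using (_∣_; divides; ∣m∣n⇒∣m+n; ∣m⇒∣-m; ∣⇒∣ᵤ)
import Data.Integer.Properties as ℤ
open import Data.Integer.Tactic.RingSolver using (solve-∀)
open import Data.List using (List; []; _∷_; _++_; replicate)
open import Data.List.Properties using (++-assoc)
open import Data.List.Relation.Unary.All using (All; []; _∷_)
open import Data.Nat as ℕ using (zero; _<_; _<ᵇ_)
import Data.Nat.Divisibility as ℕ
import Data.Nat.Properties as ℕ
open import Data.Product using (Σ; _,_; uncurry)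
open import Data.Sum as Sum using (_⊎_; inj₁; inj₂)
open import Data.Vec.Functional using (Vector; updateAt)
open import Data.Vec.Functional.Properties using (updateAt-updates; updateAt-minimal)
open import Function using (_∘_; id; const)
open import Function.Definitions using (Injective)
open import Relation.Nullary using (yes; no; ¬_)
open import Relation.Binary.PropositionalEquality

open SumProperties ℤ.+-*-semiring using (sum; sum-cong-≗; sum-replicate-zero)
open ≡-Reasoning

∑≡sum : ∀ {n} (f : Fin n → ℤ) → ∑ f ≡ sum f
∑≡sum {zero}  f = refl
∑≡sum {suc n} f = cong (_+_ (f zero)) (∑≡sum (f ∘ suc))

∑-cong : ∀ {n} {f g : Fin n → ℤ} → f ≗ g → ∑ f ≡ ∑ g
∑-cong {f = f} {g} f≗g = begin
  ∑ f    ≡⟨ ∑≡sum f ⟩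
  sum f  ≡⟨ sum-cong-≗ f≗g ⟩
  sum g  ≡⟨ ∑≡sum g ⟨
  ∑ g    ∎

∑-distrib-+ : ∀ {n} (f g : Fin n → ℤ) → ∑ (λ i → f i + g i) ≡ ∑ f + ∑ g
∑-distrib-+ f g = begin
  ∑ (λ i → f i + g i)    ≡⟨ ∑≡sum (λ i → f i + g i) ⟩
  sum (λ i → f i + g i)  ≡⟨ SumProperties.∑-distrib-+ ℤ.+-*-semiring f g ⟩
  sum f + sum g          ≡⟨ cong₂ _+_ (∑≡sum f) (∑≡sum g) ⟨
  ∑ f + ∑ g              ∎

∑-zero : ∀ {n} {f : Fin n → ℤ} → (∀ i → f i ≡ 0ℤ) → ∑ f ≡ 0ℤ
∑-zero {n} f≗0 = trans (∑-cong f≗0) (trans (∑≡sum {n} (const 0ℤ)) (sum-replicate-zero n))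

∑-cancelling-pair : ∀ {n} (c : Fin n) {f : Fin (suc n) → ℤ} →
  (∀ j → j ≢ inject₁ c → j ≢ suc c → f j ≡ 0ℤ) → f (inject₁ c) + f (suc c) ≡ 0ℤ → ∑ f ≡ 0ℤ
∑-cancelling-pair {suc n} zero {f} others pair = begin
  f 0F + (f 1F + ∑ (λ j → f (suc (suc j))))  ≡⟨ ℤ.+-assoc (f 0F) (f 1F) _ ⟨
  f 0F + f 1F + ∑ (λ j → f (suc (suc j)))    ≡⟨ cong₂ _+_ pair (∑-zero (λ j → others (suc (suc j)) (λ ()) (λ ()))) ⟩
  0ℤ                                         ∎
∑-cancelling-pair {suc n} (suc c) {f} others pair =
  cong₂ _+_ (others zero (λ ()) (λ ())) (∑-cancelling-pair c others′ pair)
  where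
  others′ : ∀ j → j ≢ inject₁ c → j ≢ suc c → f (suc j) ≡ 0ℤ
  others′ j j≢c j≢c+1 = others (suc j) (j≢c ∘ suc-injective) (j≢c+1 ∘ suc-injective)

-- Elementary column operations

infix 4 _≈_
_≈_ : ∀ {n} → Mat n → Mat n → Set
M ≈ N = ∀ i j → M i j ≡ N i j

Gram : ∀ {n} → Mat n → Mat n → Mat n
Gram A P = transpose P ⊗ A ⊗ P

addCol : ∀ {n} → Fin n → Fin n → Mat n → Mat n
addCol a b M i = updateAt (M i) b (_+ M i a)

addRow : ∀ {n} → Fin n → Fin n → Mat n → Mat n
addRow a b M = transpose (addCol a b (transpose M))

addRowCol : ∀ {n} → Fin n → Fin n → Mat n → Mat n
addRowCol a b M = addCol a b (addRow a b M)

module _ {n} {a b : Fin n} (M : Mat n) where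

  addCol-updates : ∀ i → addCol a b M i b ≡ M i b + M i a
  addCol-updates i = updateAt-updates b (M i)

  addCol-minimal : ∀ {i j} → j ≢ b → addCol a b M i j ≡ M i j
  addCol-minimal {i} {j} j≢b = updateAt-minimal j b (M i) j≢b

  addRow-updates : ∀ j → addRow a b M b j ≡ M b j + M a j
  addRow-updates j = updateAt-updates b (transpose M j)

  addRow-minimal : ∀ {i j} → i ≢ b → addRow a b M i j ≡ M i j
  addRow-minimal {i} {j} i≢b = updateAt-minimal i b (transpose M j) i≢b

module _ {A B : Set} (R : A → B → Set) {m n} {ι : Fin m → Fin n} (ι-injective : Injective _≡_ _≡_ ι) where

  updateAt-along : ∀ {xs : Vector A n} {ys : Vector B m} c {f g} →
    (∀ x → R (xs (ι x)) (ys x)) → (R (xs (ι c)) (ys c) → R (f (xs (ι c))) (g (ys c))) →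
    ∀ x → R (updateAt xs (ι c) f (ι x)) (updateAt ys c g x)
  updateAt-along {xs} {ys} c related f~g x with x ≟ᶠ c
  ... | yes refl = subst₂ R (sym (updateAt-updates (ι c) xs)) (sym (updateAt-updates c ys)) (f~g (related c))
  ... | no x≢c   = subst₂ R (sym (updateAt-minimal (ι x) (ι c) xs (x≢c ∘ ι-injective)))
                             (sym (updateAt-minimal x c ys x≢c)) (related x)

module _ {R : ℤ → ℤ → Set} (R-+ : ∀ {x x′ y y′} → R x x′ → R y y′ → R (x + y) (x′ + y′))
         {m n} {ι : Fin m → Fin n} (ι-injective : Injective _≡_ _≡_ ι) {G : Mat n} {W : Mat m}
         (a b : Fin m) where

  addCol-along : (∀ x y → R (G (ι x) (ι y)) (W x y)) →
    ∀ x y → R (addCol (ι a) (ι b) G (ι x) (ι y)) (addCol a b W x y)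
  addCol-along related x = updateAt-along R ι-injective b (related x) (λ r → R-+ r (related x a))

  addRow-along : (∀ x y → R (G (ι x) (ι y)) (W x y)) →
    ∀ x y → R (addRow (ι a) (ι b) G (ι x) (ι y)) (addRow a b W x y)
  addRow-along related x y = updateAt-along R ι-injective b (λ x → related x y) (λ r → R-+ r (related a y)) x

addCol-cong : ∀ {n} {a b : Fin n} {M N : Mat n} → M ≈ N → addCol a b M ≈ addCol a b N
addCol-cong {a = a} {b} {M} {N} = addCol-along {R = _≡_} (cong₂ _+_) {ι = id} (λ eq → eq) {G = M} {W = N} a b

⊗-congˡ : ∀ {n} {M M′ N : Mat n} → M ≈ M′ → M ⊗ N ≈ M′ ⊗ N
⊗-congˡ {N = N} M≈M′ i j = ∑-cong (λ k → cong (_* N k j) (M≈M′ i k))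

⊗-addCol : ∀ {n} {a b : Fin n} (M N : Mat n) → M ⊗ addCol a b N ≈ addCol a b (M ⊗ N)
⊗-addCol {a = a} {b} M N i j with j ≟ᶠ b
... | yes refl = begin
  ∑ (λ k → M i k * addCol a b N k b)          ≡⟨ ∑-cong (λ k → cong (M i k *_) (addCol-updates N k)) ⟩
  ∑ (λ k → M i k * (N k b + N k a))           ≡⟨ ∑-cong (λ k → ℤ.*-distribˡ-+ (M i k) (N k b) (N k a)) ⟩
  ∑ (λ k → M i k * N k b + M i k * N k a)     ≡⟨ ∑-distrib-+ (λ k → M i k * N k b) (λ k → M i k * N k a) ⟩
  (M ⊗ N) i b + (M ⊗ N) i a                   ≡⟨ addCol-updates (M ⊗ N) i ⟨
  addCol a b (M ⊗ N) i b                      ∎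
... | no j≢b = trans (∑-cong (λ k → cong (M i k *_) (addCol-minimal N j≢b))) (sym (addCol-minimal (M ⊗ N) j≢b))

addRow-⊗ : ∀ {n} {a b : Fin n} (M N : Mat n) → addRow a b M ⊗ N ≈ addRow a b (M ⊗ N)
addRow-⊗ {a = a} {b} M N i j with i ≟ᶠ b
... | yes refl = begin
  ∑ (λ k → addRow a b M b k * N k j)          ≡⟨ ∑-cong (λ k → cong (_* N k j) (addRow-updates M k)) ⟩
  ∑ (λ k → (M b k + M a k) * N k j)           ≡⟨ ∑-cong (λ k → ℤ.*-distribʳ-+ (N k j) (M b k) (M a k)) ⟩
  ∑ (λ k → M b k * N k j + M a k * N k j)     ≡⟨ ∑-distrib-+ (λ k → M b k * N k j) (λ k → M a k * N k j) ⟩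
  (M ⊗ N) b j + (M ⊗ N) a j                   ≡⟨ addRow-updates (M ⊗ N) j ⟨
  addRow a b (M ⊗ N) b j                      ∎
... | no i≢b = trans (∑-cong (λ k → cong (_* N k j) (addRow-minimal M i≢b))) (sym (addRow-minimal (M ⊗ N) i≢b))

-- The first step is definitional: transpose (addCol a b P) is addRow a b (transpose P).
Gram-addCol : ∀ {n} {a b : Fin n} (A P : Mat n) → Gram A (addCol a b P) ≈ addRowCol a b (Gram A P)
Gram-addCol {a = a} {b} A P i j = begin
  (addRow a b (transpose P) ⊗ A ⊗ addCol a b P) i j  ≡⟨ ⊗-addCol (addRow a b (transpose P) ⊗ A) P i j ⟩
  addCol a b (addRow a b (transpose P) ⊗ A ⊗ P) i j  ≡⟨ addCol-cong pull-addRow i j ⟩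
  addRowCol a b (Gram A P) i j                       ∎
  where
  pull-addRow : addRow a b (transpose P) ⊗ A ⊗ P ≈ addRow a b (Gram A P)
  pull-addRow i j = trans (⊗-congˡ {N = P} (addRow-⊗ (transpose P) A) i j) (addRow-⊗ (transpose P ⊗ A) P i j)

-- Determinants

minor : ∀ {n} → Mat (suc n) → Fin (suc n) → Mat n
minor M j a b = M (suc a) (punchIn j b)

det-cong : ∀ {n} {M N : Mat n} → M ≈ N → det M ≡ det N
det-cong {zero}  M≈N = refl
det-cong {suc n} M≈N = ∑-cong λ j →
  cong₂ (λ x d → sgn (toℕ j) * x * d) (M≈N zero j) (det-cong (λ a b → M≈N (suc a) (punchIn j b)))

punchIn≢ : ∀ {n} {j c : Fin (suc n)} (j≢c : j ≢ c) {b} → b ≢ punchOut j≢c → punchIn j b ≢ c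
punchIn≢ {j = j} j≢c b≢c′ eq = b≢c′ (punchIn-injective j _ _ (trans eq (sym (punchIn-punchOut j≢c))))

det-additive-column : ∀ {n} (c : Fin n) {M M₁ M₂ : Mat n} →
  (∀ i {j} → j ≢ c → M₁ i j ≡ M i j) → (∀ i {j} → j ≢ c → M₂ i j ≡ M i j) →
  (∀ i → M i c ≡ M₁ i c + M₂ i c) → det M ≡ det M₁ + det M₂
det-additive-column {suc n} c {M} {M₁} {M₂} M₁≡M M₂≡M split =
  trans (∑-cong expand) (∑-distrib-+ (term M₁) (term M₂))
  where
  term : Mat (suc n) → Fin (suc n) → ℤ
  term N j = sgn (toℕ j) * N zero j * det (minor N j)

  expand : ∀ j → term M j ≡ term M₁ j + term M₂ j
  expand j with j ≟ᶠ c
  ... | yes refl = begin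
    s * M zero j * d                       ≡⟨ cong (λ x → s * x * d) (split zero) ⟩
    s * (M₁ zero j + M₂ zero j) * d        ≡⟨ distribute s (M₁ zero j) (M₂ zero j) d ⟩
    s * M₁ zero j * d + s * M₂ zero j * d  ≡⟨ cong₂ (λ d₁ d₂ → s * M₁ zero j * d₁ + s * M₂ zero j * d₂)
                                                    (same-minor M₁≡M) (same-minor M₂≡M) ⟩
    term M₁ j + term M₂ j                  ∎
    where
    s = sgn (toℕ j)
    d = det (minor M j)
    distribute : ∀ s x y d → s * (x + y) * d ≡ s * x * d + s * y * d
    distribute = solve-∀
    same-minor : ∀ {N} → (∀ i {k} → k ≢ j → N i k ≡ M i k) → d ≡ det (minor N j)
    same-minor N≡M = det-cong (λ a b → sym (N≡M (suc a) (punchInᵢ≢i j b)))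
  ... | no j≢c = begin
    s * M zero j * det (minor M j)  ≡⟨ cong (s * M zero j *_) minors ⟩
    s * M zero j * (d₁ + d₂)        ≡⟨ ℤ.*-distribˡ-+ (s * M zero j) d₁ d₂ ⟩
    s * M zero j * d₁ + s * M zero j * d₂
      ≡⟨ cong₂ (λ x y → s * x * d₁ + s * y * d₂) (M₁≡M zero j≢c) (M₂≡M zero j≢c) ⟨
    term M₁ j + term M₂ j           ∎
    where
    s = sgn (toℕ j)
    d₁ = det (minor M₁ j)
    d₂ = det (minor M₂ j)
    minors : det (minor M j) ≡ d₁ + d₂
    minors = det-additive-column (punchOut j≢c)
      (λ a → M₁≡M (suc a) ∘ punchIn≢ j≢c) (λ a → M₂≡M (suc a) ∘ punchIn≢ j≢c)
      (λ a → subst (λ c → M (suc a) c ≡ M₁ (suc a) c + M₂ (suc a) c) (sym (punchIn-punchOut j≢c)) (split (suc a)))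

punchIn-adjacent : ∀ {m} {A : Set} (c : Fin m) (g : Fin (suc m) → A) → g (inject₁ c) ≡ g (suc c) →
  ∀ b → g (punchIn (inject₁ c) b) ≡ g (punchIn (suc c) b)
punchIn-adjacent zero    g equal zero    = sym equal
punchIn-adjacent zero    g equal (suc b) = refl
punchIn-adjacent (suc c) g equal zero    = refl
punchIn-adjacent (suc c) g equal (suc b) = punchIn-adjacent c (g ∘ suc) equal b

punchOut-adjacent : ∀ {m} (c : Fin (suc m)) (j : Fin (suc (suc m))) → j ≢ inject₁ c → j ≢ suc c →
  ∃[ c′ ] punchIn j (inject₁ c′) ≡ inject₁ c × punchIn j (suc c′) ≡ suc c
punchOut-adjacent zero          zero          j≢c _      = ⊥-elim (j≢c refl)
punchOut-adjacent zero          (suc zero)    _   j≢c+1  = ⊥-elim (j≢c+1 refl)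
punchOut-adjacent {suc m} zero  (suc (suc j)) _   _      = zero , refl , refl
punchOut-adjacent {suc m} (suc c) zero        _   _      = c , refl , refl
punchOut-adjacent {suc m} (suc c) (suc j) j≢c j≢c+1
  with c′ , left , right ← punchOut-adjacent c j (j≢c ∘ cong suc) (j≢c+1 ∘ cong suc)
  = suc c′ , cong suc left , cong suc right

det-equal-adjacent-columns : ∀ {n} (M : Mat (suc n)) (c : Fin n) →
  (∀ i → M i (inject₁ c) ≡ M i (suc c)) → det M ≡ 0ℤ
det-equal-adjacent-columns {suc n} M c equal = ∑-cancelling-pair c others pair
  where
  term : Fin (suc (suc n)) → ℤ
  term j = sgn (toℕ j) * M zero j * det (minor M j)

  others : ∀ j → j ≢ inject₁ c → j ≢ suc c → term j ≡ 0ℤ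
  others j j≢c j≢c+1 with c′ , left , right ← punchOut-adjacent c j j≢c j≢c+1 =
    trans (cong (sgn (toℕ j) * M zero j *_) (det-equal-adjacent-columns (minor M j) c′ equal′))
          (ℤ.*-zeroʳ (sgn (toℕ j) * M zero j))
    where
    equal′ : ∀ a → minor M j a (inject₁ c′) ≡ minor M j a (suc c′)
    equal′ a = trans (cong (M (suc a)) left) (trans (equal (suc a)) (cong (M (suc a)) (sym right)))

  cancel : ∀ s x d → s * x * d + - s * x * d ≡ 0ℤ
  cancel = solve-∀

  pair : term (inject₁ c) + term (suc c) ≡ 0ℤ
  pair = begin
    sgn (toℕ (inject₁ c)) * M zero (inject₁ c) * det (minor M (inject₁ c)) + term (suc c)
      ≡⟨ cong (λ k → sgn k * M zero (inject₁ c) * det (minor M (inject₁ c)) + term (suc c)) (toℕ-inject₁ c) ⟩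
    sgn (toℕ c) * M zero (inject₁ c) * det (minor M (inject₁ c)) + term (suc c)
      ≡⟨ cong₂ (λ x d → sgn (toℕ c) * x * d + term (suc c)) (equal zero)
               (det-cong (λ a → punchIn-adjacent c (M (suc a)) (equal (suc a)))) ⟩
    sgn (toℕ c) * M zero (suc c) * det (minor M (suc c)) + - sgn (toℕ c) * M zero (suc c) * det (minor M (suc c))
      ≡⟨ cancel (sgn (toℕ c)) (M zero (suc c)) (det (minor M (suc c))) ⟩
    0ℤ ∎

Adjacent : ∀ {n} → Fin n → Fin n → Set
Adjacent a b = toℕ b ≡ suc (toℕ a) ⊎ toℕ a ≡ suc (toℕ b)

Adjacent⇒≢ : ∀ {n} {a b : Fin n} → Adjacent a b → a ≢ b
Adjacent⇒≢ (inj₁ b≡a+1) refl = ℕ.1+n≢n (sym b≡a+1)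
Adjacent⇒≢ (inj₂ a≡b+1) refl = ℕ.1+n≢n (sym a≡b+1)

inject₁-adjacent : ∀ {n} {a b : Fin (suc n)} → toℕ b ≡ suc (toℕ a) → ∃[ c ] inject₁ c ≡ a × suc c ≡ b
inject₁-adjacent {suc n} {zero}  {suc zero} refl = zero , refl , refl
inject₁-adjacent {suc n} {suc a} {suc b}    b≡a+1
  with c , left , right ← inject₁-adjacent (ℕ.suc-injective b≡a+1) = suc c , cong suc left , cong suc right

det-equal-columns : ∀ {n} {a b : Fin n} (M : Mat n) → Adjacent a b → (∀ i → M i a ≡ M i b) → det M ≡ 0ℤ
det-equal-columns {suc n} M (inj₁ b≡a+1) equal
  with c , refl , refl ← inject₁-adjacent b≡a+1 = det-equal-adjacent-columns M c equal
det-equal-columns {suc n} M (inj₂ a≡b+1) equal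
  with c , refl , refl ← inject₁-adjacent a≡b+1 = det-equal-adjacent-columns M c (sym ∘ equal)

det-addCol : ∀ {n} {a b : Fin n} (M : Mat n) → Adjacent a b → det (addCol a b M) ≡ det M
det-addCol {a = a} {b} M adjacent = begin
  det (addCol a b M)  ≡⟨ det-additive-column b (λ i → sym ∘ addCol-minimal M) copy≡ column-b ⟩
  det M + det copy    ≡⟨ cong (_+_ (det M)) (det-equal-columns copy adjacent copy-equal) ⟩
  det M + 0ℤ          ≡⟨ ℤ.+-identityʳ (det M) ⟩
  det M               ∎
  where
  copy : Mat _
  copy i = updateAt (M i) b (const (M i a))

  copy≡ : ∀ i {j} → j ≢ b → copy i j ≡ addCol a b M i j
  copy≡ i {j} j≢b = trans (updateAt-minimal j b (M i) j≢b) (sym (addCol-minimal M j≢b))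

  column-b : ∀ i → addCol a b M i b ≡ M i b + copy i b
  column-b i = trans (addCol-updates M i) (cong (_+_ (M i b)) (sym (updateAt-updates b (M i))))

  copy-equal : ∀ i → copy i a ≡ copy i b
  copy-equal i = trans (updateAt-minimal a b (M i) (Adjacent⇒≢ adjacent)) (sym (updateAt-updates b (M i)))

identity : ∀ {n} → Mat n
identity zero    zero    = 1ℤ
identity zero    (suc j) = 0ℤ
identity (suc i) zero    = 0ℤ
identity (suc i) (suc j) = identity i j

∑-*-identityʳ : ∀ {n} (f : Fin n → ℤ) j → ∑ (λ k → f k * identity k j) ≡ f j
∑-*-identityʳ f zero = begin
  f zero * 1ℤ + ∑ (λ k → f (suc k) * 0ℤ)  ≡⟨ cong₂ _+_ (ℤ.*-identityʳ (f zero)) (∑-zero (λ k → ℤ.*-zeroʳ (f (suc k)))) ⟩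
  f zero + 0ℤ                             ≡⟨ ℤ.+-identityʳ (f zero) ⟩
  f zero                                  ∎
∑-*-identityʳ f (suc j) = begin
  f zero * 0ℤ + ∑ (λ k → f (suc k) * identity k j)  ≡⟨ cong₂ _+_ (ℤ.*-zeroʳ (f zero)) (∑-*-identityʳ (f ∘ suc) j) ⟩
  0ℤ + f (suc j)                                    ≡⟨ ℤ.+-identityˡ (f (suc j)) ⟩
  f (suc j)                                         ∎

Gram-identity : ∀ {n} (A : Mat n) → Gram A identity ≈ A
Gram-identity A i j = begin
  ∑ (λ l → (transpose identity ⊗ A) i l * identity l j)  ≡⟨ ∑-*-identityʳ ((transpose identity ⊗ A) i) j ⟩
  ∑ (λ k → identity k i * A k j)                         ≡⟨ ∑-cong (λ k → ℤ.*-comm (identity k i) (A k j)) ⟩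
  ∑ (λ k → A k j * identity k i)                         ≡⟨ ∑-*-identityʳ (λ k → A k j) i ⟩
  A i j                                                  ∎

det-identity : ∀ {n} → det (identity {n}) ≡ 1ℤ
det-identity {zero}  = refl
det-identity {suc n} = begin
  1ℤ * 1ℤ * det (identity {n}) + ∑ (λ j → sgn (suc (toℕ j)) * 0ℤ * det (minor (identity {suc n}) (suc j)))
    ≡⟨ cong₂ _+_ (trans (ℤ.*-identityˡ (det (identity {n}))) (det-identity {n})) (∑-zero vanishing) ⟩
  1ℤ + 0ℤ ≡⟨⟩
  1ℤ      ∎
  where
  vanishing : ∀ j → sgn (suc (toℕ j)) * 0ℤ * det (minor (identity {suc n}) (suc j)) ≡ 0ℤ
  vanishing j = trans (cong (_* det (minor (identity {suc n}) (suc j))) (ℤ.*-zeroʳ (sgn (suc (toℕ j)))))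
                      (ℤ.*-zeroˡ (det (minor (identity {suc n}) (suc j))))

-- Congruence modulo d

infix 4 _≡_[mod_]
-- A record rather than a synonym for + d ∣ x - y, so that x and y are inferable.
record _≡_[mod_] (x y : ℤ) (d : ℕ) : Set where
  constructor mod-divides
  field divides-difference : + d ∣ x - y

module _ {d : ℕ} where

  ≡-mod-sym : ∀ {x y} → x ≡ y [mod d ] → y ≡ x [mod d ]
  ≡-mod-sym {x} {y} (mod-divides d∣x-y) = mod-divides (subst (+ d ∣_) (negate x y) (∣m⇒∣-m d∣x-y))
    where
    negate : ∀ x y → - (x - y) ≡ y - x
    negate = solve-∀

  ≡-mod-trans : ∀ {x y z} → x ≡ y [mod d ] → y ≡ z [mod d ] → x ≡ z [mod d ]
  ≡-mod-trans {x} {y} {z} (mod-divides d∣x-y) (mod-divides d∣y-z) =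
    mod-divides (subst (+ d ∣_) (telescope x y z) (∣m∣n⇒∣m+n d∣x-y d∣y-z))
    where
    telescope : ∀ x y z → (x - y) + (y - z) ≡ x - z
    telescope = solve-∀

  ≡-mod-+ : ∀ {x x′ y y′} → x ≡ x′ [mod d ] → y ≡ y′ [mod d ] → x + y ≡ x′ + y′ [mod d ]
  ≡-mod-+ {x} {x′} {y} {y′} (mod-divides d∣x-x′) (mod-divides d∣y-y′) =
    mod-divides (subst (+ d ∣_) (regroup x x′ y y′) (∣m∣n⇒∣m+n d∣x-x′ d∣y-y′))
    where
    regroup : ∀ x x′ y y′ → (x - x′) + (y - y′) ≡ (x + y) - (x′ + y′)
    regroup = solve-∀

  ≡-mod-unique : ∀ {a b} → a < d → b < d → + a ≡ + b [mod d ] → a ≡ b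
  ≡-mod-unique {a} {b} a<d b<d (mod-divides d∣a-b) =
    ℤ.+-injective (ℤ.i-j≡0⇒i≡j (+ a) (+ b) (ℤ.∣i∣≡0⇒i≡0 (small-multiple (∣⇒∣ᵤ d∣a-b) distance<d)))
    where
    distance<d : ℤ.∣ + a - + b ∣ < d
    distance<d = ℕ.≤-<-trans (ℕ.≤-trans (ℕ.≤-reflexive (cong ℤ.∣_∣ (ℤ.[+m]-[+n]≡m⊖n a b))) (ℤ.∣m⊝n∣≤m⊔n a b))
                             (ℕ.⊔-lub a<d b<d)
    small-multiple : ∀ {t} → d ℕ.∣ t → t < d → t ≡ 0
    small-multiple {zero}  _   _   = refl
    small-multiple {suc t} d∣t t<d = ⊥-elim (ℕ.>⇒∤ t<d d∣t)

  module _ .{{_ : ℕ.NonZero d}} where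

    ≡-mod-%ℕ : ∀ x → x ≡ + (x %ℕ d) [mod d ]
    ≡-mod-%ℕ x = mod-divides (divides (x /ℕ d) (begin
      x - + (x %ℕ d)                            ≡⟨ cong (_- + (x %ℕ d)) (a≡a%ℕn+[a/ℕn]*n x d) ⟩
      + (x %ℕ d) + x /ℕ d * + d - + (x %ℕ d)    ≡⟨ cancel (+ (x %ℕ d)) (x /ℕ d * + d) ⟩
      x /ℕ d * + d                              ∎))
      where
      cancel : ∀ r q → r + q - r ≡ q
      cancel = solve-∀

    %ℕ≡⇒≡-mod : ∀ {x r} → x %ℕ d ≡ r → x ≡ + r [mod d ]
    %ℕ≡⇒≡-mod {x} refl = ≡-mod-%ℕ x

    ≡-mod⇒%ℕ≡ : ∀ {x y} → x ≡ y [mod d ] → x %ℕ d ≡ y %ℕ d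
    ≡-mod⇒%ℕ≡ {x} {y} x≡y = ≡-mod-unique (n%ℕd<d x d) (n%ℕd<d y d)
      (≡-mod-trans (≡-mod-sym (≡-mod-%ℕ x)) (≡-mod-trans x≡y (≡-mod-%ℕ y)))

-- Congruence moves inside a window

addRowCols : ∀ {n} → List (Fin n × Fin n) → Mat n → Mat n
addRowCols []                M = M
addRowCols ((a , b) ∷ moves) M = addRowCols moves (addRowCol a b M)

module _ {n w} (ι : Fin w → Fin n) where

  Outside : Fin n → Set
  Outside u = ∀ x → u ≢ ι x

  record Windowed (d : ℕ) (G₀ : Mat n) (W : Mat w) (G : Mat n) : Set where
    field
      outside : ∀ {u v} → Outside u → Outside v → G u v ≡ G₀ u v
      rows    : ∀ x {v} → Outside v → G (ι x) v ≡ 0ℤ [mod d ]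
      columns : ∀ {u} y → Outside u → G u (ι y) ≡ 0ℤ [mod d ]
      block   : ∀ x y → G (ι x) (ι y) ≡ W x y [mod d ]

module _ {n w} {ι : Fin w → Fin n} {d : ℕ} {G₀ : Mat n} where

  Windowed-resp-≈ : ∀ {W G G′} → G′ ≈ G → Windowed ι d G₀ W G → Windowed ι d G₀ W G′
  Windowed-resp-≈ {W} G′≈G win = record
    { outside = λ u-out v-out → trans (G′≈G _ _) (outside u-out v-out)
    ; rows    = λ x v-out → subst (_≡ 0ℤ [mod d ]) (sym (G′≈G _ _)) (rows x v-out)
    ; columns = λ y u-out → subst (_≡ 0ℤ [mod d ]) (sym (G′≈G _ _)) (columns y u-out)
    ; block   = λ x y → subst (_≡ W x y [mod d ]) (sym (G′≈G _ _)) (block x y)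
    }
    where open Windowed win

  module _ (ι-injective : Injective _≡_ _≡_ ι) where

    Windowed-addRowCol : ∀ a b {W G} → Windowed ι d G₀ W G →
      Windowed ι d G₀ (addRowCol a b W) (addRowCol (ι a) (ι b) G)
    Windowed-addRowCol a b {W} {G} win = record
      { outside = λ {u} {v} u-out v-out → begin
          addRowCol (ι a) (ι b) G u v  ≡⟨ addCol-minimal (addRow (ι a) (ι b) G) (v-out b) ⟩
          addRow (ι a) (ι b) G u v     ≡⟨ addRow-minimal G (u-out b) ⟩
          G u v                        ≡⟨ outside u-out v-out ⟩
          G₀ u v                       ∎
      ; rows    = λ x v-out →
          subst (_≡ 0ℤ [mod d ]) (sym (addCol-minimal (addRow (ι a) (ι b) G) (v-out b))) (row x v-out)
      ; columns = column
      ; block   = addCol-along {R = _≡_[mod d ]} ≡-mod-+ ι-injective {G = addRow (ι a) (ι b) G} a b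
                    (addRow-along {R = _≡_[mod d ]} ≡-mod-+ ι-injective {G = G} {W = W} a b block)
      }
      where
      open Windowed win

      row : ∀ x {v} → Outside ι v → addRow (ι a) (ι b) G (ι x) v ≡ 0ℤ [mod d ]
      row x {v} v-out with x ≟ᶠ b
      ... | yes refl = subst (_≡ 0ℤ [mod d ]) (sym (addRow-updates G v)) (≡-mod-+ (rows b v-out) (rows a v-out))
      ... | no x≢b   = subst (_≡ 0ℤ [mod d ]) (sym (addRow-minimal G (x≢b ∘ ι-injective))) (rows x v-out)

      column-unchanged : ∀ {u} y → Outside ι u → addRow (ι a) (ι b) G u (ι y) ≡ 0ℤ [mod d ]
      column-unchanged y u-out = subst (_≡ 0ℤ [mod d ]) (sym (addRow-minimal G (u-out b))) (columns y u-out)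

      column : ∀ {u} y → Outside ι u → addRowCol (ι a) (ι b) G u (ι y) ≡ 0ℤ [mod d ]
      column {u} y u-out with y ≟ᶠ b
      ... | yes refl = subst (_≡ 0ℤ [mod d ]) (sym (addCol-updates (addRow (ι a) (ι b) G) u))
                             (≡-mod-+ (column-unchanged b u-out) (column-unchanged a u-out))
      ... | no y≢b   = subst (_≡ 0ℤ [mod d ]) (sym (addCol-minimal (addRow (ι a) (ι b) G) (y≢b ∘ ι-injective)))
                             (column-unchanged y u-out)

    Windowed-addRowCols : (∀ {a b} → Adjacent a b → Adjacent (ι a) (ι b)) →
      ∀ {A P : Mat n} {W} moves → All (uncurry Adjacent) moves → Windowed ι d G₀ W (Gram A P) →
      ∃[ P′ ] det P′ ≡ det P × Windowed ι d G₀ (addRowCols moves W) (Gram A P′)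
    Windowed-addRowCols ι-adjacent []                _                 win = _ , refl , win
    Windowed-addRowCols ι-adjacent {A} {P} ((a , b) ∷ moves) (adjacent ∷ adjacents) win
      with P′ , det≡ , win′ ← Windowed-addRowCols ι-adjacent moves adjacents
                                (Windowed-resp-≈ (Gram-addCol A P) (Windowed-addRowCol a b win))
      = P′ , trans det≡ (det-addCol P (ι-adjacent adjacent)) , win′

-- Block diagonal matrices

dim-++ : ∀ X L → dim (X ++ L) ≡ dim X ℕ.+ dim L
dim-++ []      L = refl
dim-++ (b ∷ X) L = trans (cong (blockSize b ℕ.+_) (dim-++ X L)) (sym (ℕ.+-assoc (blockSize b) (dim X) (dim L)))

blockMatrix : ∀ W → Mat (dim W)
blockMatrix W x y = + diagEntry W (toℕ x) (toℕ y)

diagEntry-∷-shift : ∀ b bs u v → diagEntry (b ∷ bs) (blockSize b ℕ.+ u) (blockSize b ℕ.+ v) ≡ diagEntry bs u v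
diagEntry-∷-shift H    _ _ _ = refl
diagEntry-∷-shift U    _ _ _ = refl
diagEntry-∷-shift V    _ _ _ = refl
diagEntry-∷-shift Two  _ _ _ = refl
diagEntry-∷-shift Zero _ _ _ = refl

diagEntry-++-shift : ∀ X L u v → diagEntry (X ++ L) (dim X ℕ.+ u) (dim X ℕ.+ v) ≡ diagEntry L u v
diagEntry-++-shift []      L u v = refl
diagEntry-++-shift (b ∷ X) L u v = begin
  diagEntry (b ∷ X ++ L) (blockSize b ℕ.+ dim X ℕ.+ u) (blockSize b ℕ.+ dim X ℕ.+ v)
    ≡⟨ cong₂ (diagEntry (b ∷ X ++ L)) (ℕ.+-assoc (blockSize b) (dim X) u) (ℕ.+-assoc (blockSize b) (dim X) v) ⟩
  diagEntry (b ∷ X ++ L) (blockSize b ℕ.+ (dim X ℕ.+ u)) (blockSize b ℕ.+ (dim X ℕ.+ v))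
    ≡⟨ diagEntry-∷-shift b (X ++ L) (dim X ℕ.+ u) (dim X ℕ.+ v) ⟩
  diagEntry (X ++ L) (dim X ℕ.+ u) (dim X ℕ.+ v)
    ≡⟨ diagEntry-++-shift X L u v ⟩
  diagEntry L u v ∎

private
  <ᵇ-true⇒< : ∀ {u s} → (u <ᵇ s) ≡ true → u < s
  <ᵇ-true⇒< {u} {s} eq = ℕ.<ᵇ⇒< u s (subst T (sym eq) _)

  <ᵇ-false⇒≥ : ∀ {u s} → (u <ᵇ s) ≡ false → s ≤ u
  <ᵇ-false⇒≥ eq = ℕ.≮⇒≥ (λ u<s → subst T eq (ℕ.<⇒<ᵇ u<s))

  <ᵇ-false⇒∸< : ∀ {u s k} → (u <ᵇ s) ≡ false → u < s ℕ.+ k → u ∸ s < k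
  <ᵇ-false⇒∸< {u} {s} {k} u≮s u<s+k = subst (u ∸ s <_) (ℕ.m+n∸m≡n s k) (ℕ.∸-monoˡ-< u<s+k (<ᵇ-false⇒≥ {s = s} u≮s))

  m+n≤o⇒n≤o∸m : ∀ {v s k} → s ℕ.+ k ≤ v → k ≤ v ∸ s
  m+n≤o⇒n≤o∸m {v} {s} {k} s+k≤v = ℕ.m+n≤o⇒m≤o∸n k (subst (_≤ v) (ℕ.+-comm s k) s+k≤v)

diagEntry-++-prefix : ∀ X L {u v} → u < dim X → v < dim X → diagEntry (X ++ L) u v ≡ diagEntry X u v
diagEntry-++-prefix []      L ()
diagEntry-++-prefix (b ∷ X) L {u} {v} u<dim v<dim with u <ᵇ blockSize b in u∈b | v <ᵇ blockSize b in v∈b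
... | true  | _     = refl
... | false | true  = refl
... | false | false = diagEntry-++-prefix X L (<ᵇ-false⇒∸< u∈b u<dim) (<ᵇ-false⇒∸< v∈b v<dim)

Straddles : ℕ → ℕ → ℕ → Set
Straddles k u v = (u < k × k ≤ v) ⊎ (v < k × k ≤ u)

diagEntry-++-straddle : ∀ X L {u v} → Straddles (dim X) u v → diagEntry (X ++ L) u v ≡ 0
diagEntry-++-straddle []      L (inj₁ (() , _))
diagEntry-++-straddle []      L (inj₂ (() , _))
diagEntry-++-straddle (b ∷ X) L {u} {v} straddle with u <ᵇ blockSize b in u∈b | v <ᵇ blockSize b in v∈b
... | true  | true  =
  ⊥-elim (Sum.[ (λ (_ , b+X≤v) → beyond v∈b b+X≤v) , (λ (_ , b+X≤u) → beyond u∈b b+X≤u) ] straddle)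
  where
  beyond : ∀ {t} → (t <ᵇ blockSize b) ≡ true → ¬ (blockSize b ℕ.+ dim X ≤ t)
  beyond t∈b b+X≤t = ℕ.<⇒≱ (<ᵇ-true⇒< t∈b) (ℕ.≤-trans (ℕ.m≤m+n (blockSize b) (dim X)) b+X≤t)
... | true  | false = refl
... | false | true  = refl
... | false | false = diagEntry-++-straddle X L (Sum.map (λ (u< , ≤v) → <ᵇ-false⇒∸< u∈b u< , m+n≤o⇒n≤o∸m ≤v)
                                                       (λ (v< , ≤u) → <ᵇ-false⇒∸< v∈b v< , m+n≤o⇒n≤o∸m ≤u) straddle)

window : ∀ k {w} l → Fin w → Fin (k ℕ.+ (w ℕ.+ l))
window k l x = k ↑ʳ (x ↑ˡ l)

data OffWindow (k w : ℕ) : ℕ → Set where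
  before : ∀ {u} → u < k → OffWindow k w u
  after  : ∀ j → OffWindow k w (k ℕ.+ (w ℕ.+ j))

-- The index in X ++ Y of an index of X ++ W ++ Y off the window.
squeeze : ∀ {k w u} → OffWindow k w u → ℕ
squeeze {u = u} (before _) = u
squeeze {k}     (after j)  = k ℕ.+ j

module _ (k : ℕ) {w : ℕ} (l : ℕ) where

  toℕ-window : ∀ (x : Fin w) → toℕ (window k l x) ≡ k ℕ.+ toℕ x
  toℕ-window x = trans (toℕ-↑ʳ k (x ↑ˡ l)) (cong (k ℕ.+_) (toℕ-↑ˡ x l))

  window-injective : Injective _≡_ _≡_ (window k {w} l)
  window-injective eq = ↑ˡ-injective l _ _ (↑ʳ-injective k _ _ eq)

  window-adjacent : ∀ {a b} → Adjacent a b → Adjacent (window k l a) (window k l b)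
  window-adjacent {a} {b} = Sum.map (successor a b) (successor b a)
    where
    successor : ∀ a b → toℕ b ≡ suc (toℕ a) → toℕ (window k l b) ≡ suc (toℕ (window k l a))
    successor a b b≡a+1 = begin
      toℕ (window k l b)        ≡⟨ toℕ-window b ⟩
      k ℕ.+ toℕ b               ≡⟨ cong (k ℕ.+_) b≡a+1 ⟩
      k ℕ.+ suc (toℕ a)         ≡⟨ ℕ.+-suc k (toℕ a) ⟩
      suc (k ℕ.+ toℕ a)         ≡⟨ cong suc (toℕ-window a) ⟨
      suc (toℕ (window k l a))  ∎

  offWindow : ∀ {v} → Outside (window k {w} l) v → OffWindow k w (toℕ v)
  offWindow {v} v-out with splitAt k v in split₁
  ... | inj₁ i = before (subst (_< k) (trans (sym (toℕ-↑ˡ i _)) (cong toℕ (splitAt⁻¹-↑ˡ split₁))) (toℕ<n i))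
  ... | inj₂ r with splitAt w r in split₂
  ...   | inj₁ x = ⊥-elim (v-out x (sym (trans (cong (k ↑ʳ_) (splitAt⁻¹-↑ˡ split₂)) (splitAt⁻¹-↑ʳ split₁))))
  ...   | inj₂ j = subst (OffWindow k w) toℕ-v (after (toℕ j))
    where
    toℕ-v : k ℕ.+ (w ℕ.+ toℕ j) ≡ toℕ v
    toℕ-v = begin
      k ℕ.+ (w ℕ.+ toℕ j)        ≡⟨ cong (k ℕ.+_) (toℕ-↑ʳ w j) ⟨
      k ℕ.+ toℕ (w ↑ʳ j)         ≡⟨ toℕ-↑ʳ k (w ↑ʳ j) ⟨
      toℕ (k ↑ʳ (w ↑ʳ j))        ≡⟨ cong (λ r → toℕ (k ↑ʳ r)) (splitAt⁻¹-↑ʳ split₂) ⟩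
      toℕ (k ↑ʳ r)               ≡⟨ cong toℕ (splitAt⁻¹-↑ʳ split₁) ⟩
      toℕ v                      ∎

module _ (X W Y : List Block) where

  private
    B = X ++ W ++ Y

    straddling : ∀ {u v u′ v′} → Straddles (dim X) u v → Straddles (dim X) u′ v′ →
                 diagEntry B u v ≡ diagEntry (X ++ Y) u′ v′
    straddling uv u′v′ = trans (diagEntry-++-straddle X (W ++ Y) uv) (sym (diagEntry-++-straddle X Y u′v′))

  diagEntry-window : ∀ {x y} → x < dim W → y < dim W → diagEntry B (dim X ℕ.+ x) (dim X ℕ.+ y) ≡ diagEntry W x y
  diagEntry-window {x} {y} x<W y<W = trans (diagEntry-++-shift X (W ++ Y) x y) (diagEntry-++-prefix W Y x<W y<W)

  diagEntry-window-row : ∀ {w x v} → dim W ≡ w → x < w → OffWindow (dim X) w v → diagEntry B (dim X ℕ.+ x) v ≡ 0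
  diagEntry-window-row refl x<W (before v<X) = diagEntry-++-straddle X (W ++ Y) (inj₂ (v<X , ℕ.m≤m+n _ _))
  diagEntry-window-row refl x<W (after j)    =
    trans (diagEntry-++-shift X (W ++ Y) _ (dim W ℕ.+ j)) (diagEntry-++-straddle W Y (inj₁ (x<W , ℕ.m≤m+n _ _)))

  diagEntry-window-column : ∀ {w u y} → dim W ≡ w → y < w → OffWindow (dim X) w u → diagEntry B u (dim X ℕ.+ y) ≡ 0
  diagEntry-window-column refl y<W (before u<X) = diagEntry-++-straddle X (W ++ Y) (inj₁ (u<X , ℕ.m≤m+n _ _))
  diagEntry-window-column refl y<W (after i)    =
    trans (diagEntry-++-shift X (W ++ Y) (dim W ℕ.+ i) _) (diagEntry-++-straddle W Y (inj₂ (y<W , ℕ.m≤m+n _ _)))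

  diagEntry-offWindow : ∀ {w u v} → dim W ≡ w → (ou : OffWindow (dim X) w u) (ov : OffWindow (dim X) w v) →
    diagEntry B u v ≡ diagEntry (X ++ Y) (squeeze ou) (squeeze ov)
  diagEntry-offWindow refl (before u<X) (before v<X) =
    trans (diagEntry-++-prefix X (W ++ Y) u<X v<X) (sym (diagEntry-++-prefix X Y u<X v<X))
  diagEntry-offWindow refl (before u<X) (after j)    =
    straddling (inj₁ (u<X , ℕ.m≤m+n _ _)) (inj₁ (u<X , ℕ.m≤m+n _ _))
  diagEntry-offWindow refl (after i)    (before v<X) =
    straddling (inj₂ (v<X , ℕ.m≤m+n _ _)) (inj₂ (v<X , ℕ.m≤m+n _ _))
  diagEntry-offWindow refl (after i) (after j) = begin
    diagEntry B (dim X ℕ.+ (dim W ℕ.+ i)) (dim X ℕ.+ (dim W ℕ.+ j))  ≡⟨ diagEntry-++-shift X (W ++ Y) _ _ ⟩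
    diagEntry (W ++ Y) (dim W ℕ.+ i) (dim W ℕ.+ j)                   ≡⟨ diagEntry-++-shift W Y i j ⟩
    diagEntry Y i j                                                  ≡⟨ diagEntry-++-shift X Y i j ⟨
    diagEntry (X ++ Y) (dim X ℕ.+ i) (dim X ℕ.+ j)                   ∎

-- Local moves on block lists

Reach : ∀ {n} → Mat n → List Block → Set
Reach {n} A bs = Σ (Mat n) λ P → Unimodular P × (Gram A P ≡mod4 bs)

reach-identity : ∀ {n} {A : Mat n} {bs} → A ≡mod4 bs → Reach A bs
reach-identity {n} {A} (n≡ , A≡bs) =
  identity , inj₁ (det-identity {n}) , n≡ , λ i j → trans (cong (_%ℕ 4) (Gram-identity A i j)) (A≡bs i j)

Unimodular-resp : ∀ {n} {P P′ : Mat n} → det P′ ≡ det P → Unimodular P → Unimodular P′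
Unimodular-resp det≡ = Sum.map (trans det≡) (trans det≡)

dim-++₃ : ∀ X W Y → dim (X ++ W ++ Y) ≡ dim X ℕ.+ (dim W ℕ.+ dim Y)
dim-++₃ X W Y = trans (dim-++ X (W ++ Y)) (cong (dim X ℕ.+_) (dim-++ W Y))

record LocalMove (W W′ : List Block) : Set where
  field
    moves    : List (Fin (dim W) × Fin (dim W))
    adjacent : All (uncurry Adjacent) moves
    dim≡     : dim W′ ≡ dim W
    result   : ∀ x y → addRowCols moves (blockMatrix W) x y %ℕ 4 ≡ diagEntry W′ (toℕ x) (toℕ y)

module _ (X W Y : List Block) where

  private
    ι = window (dim X) {dim W} (dim Y)
    B = X ++ W ++ Y

  window-start : ∀ {G : Mat (dim X ℕ.+ (dim W ℕ.+ dim Y))} →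
    (∀ u v → G u v %ℕ 4 ≡ diagEntry B (toℕ u) (toℕ v)) → Windowed ι 4 G (blockMatrix W) G
  window-start {G} G≡B = record
    { outside = λ _ _ → refl
    ; rows    = λ x {v} v-out → %ℕ≡⇒≡-mod (begin
        G (ι x) v %ℕ 4                      ≡⟨ G≡B (ι x) v ⟩
        diagEntry B (toℕ (ι x)) (toℕ v)     ≡⟨ cong (λ i → diagEntry B i (toℕ v)) (toℕ-window _ _ x) ⟩
        diagEntry B (dim X ℕ.+ toℕ x) (toℕ v) ≡⟨ diagEntry-window-row X W Y refl (toℕ<n x) (offWindow _ _ v-out) ⟩
        0                                   ∎)
    ; columns = λ {u} y u-out → %ℕ≡⇒≡-mod (begin
        G u (ι y) %ℕ 4                      ≡⟨ G≡B u (ι y) ⟩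
        diagEntry B (toℕ u) (toℕ (ι y))     ≡⟨ cong (diagEntry B (toℕ u)) (toℕ-window _ _ y) ⟩
        diagEntry B (toℕ u) (dim X ℕ.+ toℕ y) ≡⟨ diagEntry-window-column X W Y refl (toℕ<n y) (offWindow _ _ u-out) ⟩
        0                                   ∎)
    ; block   = λ x y → %ℕ≡⇒≡-mod (begin
        G (ι x) (ι y) %ℕ 4                  ≡⟨ G≡B (ι x) (ι y) ⟩
        diagEntry B (toℕ (ι x)) (toℕ (ι y)) ≡⟨ cong₂ (diagEntry B) (toℕ-window _ _ x) (toℕ-window _ _ y) ⟩
        diagEntry B (dim X ℕ.+ toℕ x) (dim X ℕ.+ toℕ y) ≡⟨ diagEntry-window X W Y (toℕ<n x) (toℕ<n y) ⟩
        diagEntry W (toℕ x) (toℕ y)         ∎)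
    }

  module _ {W′} (dim-W′ : dim W′ ≡ dim W) {G₀ G : Mat (dim X ℕ.+ (dim W ℕ.+ dim Y))} {W₁ : Mat (dim W)}
           (G₀≡B : ∀ u v → G₀ u v %ℕ 4 ≡ diagEntry B (toℕ u) (toℕ v))
           (W₁≡W′ : ∀ x y → W₁ x y %ℕ 4 ≡ diagEntry W′ (toℕ x) (toℕ y))
           (win : Windowed ι 4 G₀ W₁ G) where

    private
      B′ = X ++ W′ ++ Y
      open Windowed win

      in-W′ : ∀ (x : Fin (dim W)) → toℕ x < dim W′
      in-W′ x = subst (toℕ x <_) (sym dim-W′) (toℕ<n x)

    window-finish : ∀ u v → G u v %ℕ 4 ≡ diagEntry B′ (toℕ u) (toℕ v)
    window-finish u v with any? (λ x → u ≟ᶠ ι x) | any? (λ y → v ≟ᶠ ι y)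
    ... | yes (x , refl) | yes (y , refl) = begin
      G (ι x) (ι y) %ℕ 4                                ≡⟨ ≡-mod⇒%ℕ≡ (block x y) ⟩
      W₁ x y %ℕ 4                                       ≡⟨ W₁≡W′ x y ⟩
      diagEntry W′ (toℕ x) (toℕ y)                      ≡⟨ diagEntry-window X W′ Y (in-W′ x) (in-W′ y) ⟨
      diagEntry B′ (dim X ℕ.+ toℕ x) (dim X ℕ.+ toℕ y)  ≡⟨ cong₂ (diagEntry B′) (toℕ-window _ _ x) (toℕ-window _ _ y) ⟨
      diagEntry B′ (toℕ (ι x)) (toℕ (ι y))              ∎
    ... | yes (x , refl) | no v-in = begin
      G (ι x) v %ℕ 4                          ≡⟨ ≡-mod⇒%ℕ≡ (rows x v-out) ⟩
      0                                       ≡⟨ diagEntry-window-row X W′ Y dim-W′ (toℕ<n x) (offWindow _ _ v-out) ⟨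
      diagEntry B′ (dim X ℕ.+ toℕ x) (toℕ v)  ≡⟨ cong (λ i → diagEntry B′ i (toℕ v)) (toℕ-window _ _ x) ⟨
      diagEntry B′ (toℕ (ι x)) (toℕ v)        ∎
      where
      v-out : Outside ι v
      v-out y v≡ιy = v-in (y , v≡ιy)
    ... | no u-in | yes (y , refl) = begin
      G u (ι y) %ℕ 4                          ≡⟨ ≡-mod⇒%ℕ≡ (columns y u-out) ⟩
      0                                       ≡⟨ diagEntry-window-column X W′ Y dim-W′ (toℕ<n y) (offWindow _ _ u-out) ⟨
      diagEntry B′ (toℕ u) (dim X ℕ.+ toℕ y)  ≡⟨ cong (diagEntry B′ (toℕ u)) (toℕ-window _ _ y) ⟨
      diagEntry B′ (toℕ u) (toℕ (ι y))        ∎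
      where
      u-out : Outside ι u
      u-out x u≡ιx = u-in (x , u≡ιx)
    ... | no u-in | no v-in = begin
      G u v %ℕ 4                                    ≡⟨ cong (_%ℕ 4) (outside u-out v-out) ⟩
      G₀ u v %ℕ 4                                   ≡⟨ G₀≡B u v ⟩
      diagEntry B (toℕ u) (toℕ v)                   ≡⟨ diagEntry-offWindow X W Y refl ou ov ⟩
      diagEntry (X ++ Y) (squeeze ou) (squeeze ov)  ≡⟨ diagEntry-offWindow X W′ Y dim-W′ ou ov ⟨
      diagEntry B′ (toℕ u) (toℕ v)                  ∎
      where
      u-out : Outside ι u
      u-out x u≡ιx = u-in (x , u≡ιx)
      v-out : Outside ι v
      v-out y v≡ιy = v-in (y , v≡ιy)
      ou = offWindow _ _ u-out
      ov = offWindow _ _ v-out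

module _ {W W′} (move : LocalMove W W′) where

  open LocalMove move

  reach-move : ∀ {n} {A : Mat n} X Y → Reach A (X ++ W ++ Y) → Reach A (X ++ W′ ++ Y)
  reach-move {A = A} X Y (P , unimodular , n≡ , Gram≡B)
    with refl ← trans n≡ (dim-++₃ X W Y)
    with P′ , det≡ , win ← Windowed-addRowCols (window-injective _ _) (window-adjacent _ _) moves adjacent
                             (window-start X W Y Gram≡B)
    = P′ , Unimodular-resp {P = P} {P′} det≡ unimodular , dims , window-finish X W Y dim≡ Gram≡B result win
    where
    dims : dim X ℕ.+ (dim W ℕ.+ dim Y) ≡ dim (X ++ W′ ++ Y)
    dims = sym (trans (dim-++₃ X W′ Y) (cong (λ w → dim X ℕ.+ (w ℕ.+ dim Y)) dim≡))

-- Trading (2)(2)(2) for V (2)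

-- The moves replace e₀, e₁, e₂ by e₀ + e₁, e₀ + 2e₁ + e₂, e₀ + 3e₁ + 3e₂, whose Gram matrix
-- for 2I is 2 [[2,3,4],[3,6,10],[4,10,19]] ≡ diag(V, 2) (mod 4).
twos⇝V-two : LocalMove (Two ∷ Two ∷ Two ∷ []) (V ∷ Two ∷ [])
twos⇝V-two = record
  { moves    = (1F , 0F) ∷ (2F , 1F) ∷ (1F , 2F) ∷ (0F , 1F) ∷ (1F , 2F) ∷ []
  ; adjacent = inj₂ refl ∷ inj₂ refl ∷ inj₁ refl ∷ inj₁ refl ∷ inj₁ refl ∷ []
  ; dim≡     = refl
  ; result   = λ where
      0F 0F → refl ; 0F 1F → refl ; 0F 2F → refl
      1F 0F → refl ; 1F 1F → refl ; 1F 2F → refl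
      2F 0F → refl ; 2F 1F → refl ; 2F 2F → refl
  }

replicate-++-∷ : ∀ {A : Set} n (x : A) ys → replicate n x ++ x ∷ ys ≡ x ∷ replicate n x ++ ys
replicate-++-∷ zero    x ys = refl
replicate-++-∷ (suc n) x ys = cong (x ∷_) (replicate-++-∷ n x ys)

++-assoc₃ : ∀ {A : Set} (xs ys zs ws : List A) → (xs ++ ys ++ zs) ++ ws ≡ xs ++ ys ++ zs ++ ws
++-assoc₃ xs ys zs ws = trans (++-assoc xs (ys ++ zs) ws) (cong (xs ++_) (++-assoc ys zs ws))

module _ {n} {A : Mat n} (r s m : ℕ) where

  private
    prefix : ℕ → List Block
    prefix t = replicate r H ++ replicate s U ++ replicate t V

    suffix : ℕ → List Block
    suffix q = replicate q Two ++ replicate m Zero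

  trade-twos : ∀ t q → HasNormalForm A r s t (3 ℕ.+ q) m → HasNormalForm A r s (suc t) (suc q) m
  trade-twos t q N = subst (Reach A) merge (reach-move twos⇝V-two (prefix t) (suffix q) (subst (Reach A) split N))
    where
    split : normalBlocks r s t (3 ℕ.+ q) m ≡ prefix t ++ (Two ∷ Two ∷ Two ∷ []) ++ suffix q
    split = sym (++-assoc₃ (replicate r H) (replicate s U) (replicate t V) _)

    merge : prefix t ++ (V ∷ Two ∷ []) ++ suffix q ≡ normalBlocks r s (suc t) (suc q) m
    merge = trans (++-assoc₃ (replicate r H) (replicate s U) (replicate t V) _)
                  (cong (λ Z → replicate r H ++ replicate s U ++ Z) (replicate-++-∷ t V (Two ∷ suffix q)))

  reduce-twos : ∀ p t → HasNormalForm A r s t p m →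
    ∃[ r′ ] ∃[ s′ ] ∃[ t′ ] ∃[ p′ ] ∃[ m′ ] (p′ ≤ 2 × HasNormalForm A r′ s′ t′ p′ m′)
  reduce-twos 0 t N = r , s , t , 0 , m , ℕ.z≤n , N
  reduce-twos 1 t N = r , s , t , 1 , m , ℕ.s≤s ℕ.z≤n , N
  reduce-twos 2 t N = r , s , t , 2 , m , ℕ.≤-refl , N
  reduce-twos (suc (suc (suc q))) t N = reduce-twos (suc q) (suc t) (trade-twos t q N)

lemma2p3 : ∀ {n} (A : Mat n) (r s t p m : ℕ) → Symmetric A → 3 ≤ p
    → A ≡mod4 normalBlocks r s t p m
    → HasNormalForm A r s (suc t) (p ∸ 2) m
      × (∃[ r′ ] ∃[ s′ ] ∃[ t′ ] ∃[ p′ ] ∃[ m′ ] (p′ ≤ 2 × HasNormalForm A r′ s′ t′ p′ m′))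
lemma2p3 A r s t _ m _ (ℕ.s≤s (ℕ.s≤s (ℕ.s≤s (ℕ.z≤n {q})))) A≡N =
  trade-twos r s m t q N , reduce-twos r s m (3 ℕ.+ q) t N
  where
  N : HasNormalForm A r s t (3 ℕ.+ q) m
  N = reach-identity {bs = normalBlocks r s t (3 ℕ.+ q) m} A≡N
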